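{- Let $k \geq 5$ be an integer and let $G$ be a connected $SC_k$ graph. For any two distinct induced cycles $S_i$ and $S_j$ of $G$, one of the following holds: (i) $|V(S_i) \cap V(S_j)| \leq 1$; (ii) $|E(S_i) \cap E(S_j)| \leq 1$; (iii) $k$ is even and $|E(S_i) \cap E(S_j)| = \frac{k}{2}$.
   Context: All graphs are finite, simple and undirected. A graph $G$ is a strictly chordality-$k$ graph ($SC_k$ graph) if either $G$ has no cycle, or every induced cycle of $G$ has length exactly $k$. -}

module Defs where

open import Data.Nat using (ℕ; zero; suc; _≤_; _≟_)
open import Data.Fin using (Fin; toℕ; _<_) renaming (_≟_ to _≟F_; _<?_ to _<?F_)
open import Data.Fin.Properties using (any?)
open import Data.Bool using (Bool; true; false)
open import Data.List using (List; length; filter; allFin; concatMap; map)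
open import Data.Product using (Σ; ∃; _×_; _,_; proj₁; proj₂)
open import Data.Sum using (_⊎_)
open import Data.Empty using (⊥)
open import Relation.Nullary using (¬_; Dec)
open import Relation.Nullary.Decidable using (_×-dec_; _⊎-dec_)
open import Relation.Binary.PropositionalEquality using (_≡_)
open import Function.Definitions using (Injective)

record Graph : Set where
  field
    n      : ℕ
    adj    : Fin n → Fin n → Bool
    sym    : ∀ u v → adj u v ≡ adj v u
    irrefl : ∀ u → adj u u ≡ false
open Graph public

Adj : (G : Graph) → Fin (n G) → Fin (n G) → Set
Adj G u v = adj G u v ≡ true

CycSucc : (m : ℕ) → Fin m → Fin m → Set
CycSucc m i j = (suc (toℕ i) ≡ toℕ j) ⊎ ((suc (toℕ i) ≡ m) × (toℕ j ≡ 0))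

cycSucc? : (m : ℕ) → (i j : Fin m) → Dec (CycSucc m i j)
cycSucc? m i j = (suc (toℕ i) ≟ toℕ j) ⊎-dec ((suc (toℕ i) ≟ m) ×-dec (toℕ j ≟ 0))

record Cycle (G : Graph) : Set where
  field
    len    : ℕ
    len≥3  : 3 ≤ len
    vert   : Fin len → Fin (n G)
    inj    : Injective _≡_ _≡_ vert
    closed : ∀ i j → CycSucc len i j → Adj G (vert i) (vert j)
open Cycle public

record InducedCycle (G : Graph) : Set where
  field
    cyc     : Cycle G
    induced : ∀ i j → Adj G (vert cyc i) (vert cyc j) →
              CycSucc (len cyc) i j ⊎ CycSucc (len cyc) j i
open InducedCycle public

InV : {G : Graph} → Cycle G → Fin (n G) → Set
InV C v = ∃ λ i → vert C i ≡ v

inV? : {G : Graph} (C : Cycle G) (v : Fin (n G)) → Dec (InV C v)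
inV? C v = any? (λ i → vert C i ≟F v)

InE : {G : Graph} → Cycle G → Fin (n G) → Fin (n G) → Set
InE C u v = ∃ λ i → ∃ λ j → CycSucc (len C) i j ×
              (((vert C i ≡ u) × (vert C j ≡ v)) ⊎ ((vert C i ≡ v) × (vert C j ≡ u)))

inE? : {G : Graph} (C : Cycle G) (u v : Fin (n G)) → Dec (InE C u v)
inE? C u v = any? λ i → any? λ j → cycSucc? (len C) i j ×-dec
  (((vert C i ≟F u) ×-dec (vert C j ≟F v)) ⊎-dec ((vert C i ≟F v) ×-dec (vert C j ≟F u)))

SameSubgraph : {G : Graph} → Cycle G → Cycle G → Set
SameSubgraph C D = (∀ v → (InV C v → InV D v) × (InV D v → InV C v))
                 × (∀ u v → (InE C u v → InE D u v) × (InE D u v → InE C u v))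

commonVertices : {G : Graph} → Cycle G → Cycle G → ℕ
commonVertices {G} C D = length (filter (λ v → inV? C v ×-dec inV? D v) (allFin (n G)))

-- |E(C) ∩ E(D)|: unordered pairs {u,v} (counted once, as u < v).
allPairs : (m : ℕ) → List (Fin m × Fin m)
allPairs m = concatMap (λ u → map (λ v → u , v) (allFin m)) (allFin m)

commonEdges : {G : Graph} → Cycle G → Cycle G → ℕ
commonEdges {G} C D = length (filter
  (λ p → (proj₁ p <?F proj₂ p) ×-dec (inE? C (proj₁ p) (proj₂ p) ×-dec inE? D (proj₁ p) (proj₂ p)))
  (allPairs (n G)))

data Walk (G : Graph) : Fin (n G) → Fin (n G) → Set where
  here : ∀ {u} → Walk G u u
  step : ∀ {u w v} → Adj G u w → Walk G w v → Walk G u v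

Connected : Graph → Set
Connected G = ∀ u v → Walk G u v

SC : ℕ → Graph → Set
SC k G = (¬ Cycle G) ⊎ (∀ (C : InducedCycle G) → len (cyc C) ≡ k)

-- Let Si ≠ Sj be induced k-cycles sharing at least two edges. Since they differ, Si has an
-- unshared edge, hence an ear: a segment of q ≥ 2 edges meeting Sj only at its ends. Closing the
-- ear with either arc of Sj between its ends gives two cycles of total length 2q + k. In an SC_k
-- graph a non-induced cycle splits along a chord into two shorter cycles, so every cycle has
-- length ≥ k, and one of length < 2k − 2 has length exactly k; thus 2q ≥ k. A second ear would
-- also have length ≥ k/2 and so, together with the first, would fill up Si, leaving no shared
-- edge; hence the k − q edges of Si after the ear are all shared. They run along Sj in one
-- direction and therefore cover one of the two arcs, whose length is then k − q. The other arc
-- has length q, and the ear closed with it is a cycle of length 2q ≤ 2k − 4 (two shared edges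
-- force q ≤ k − 2), so 2q = k and exactly q = k/2 edges are shared.
module Submission where

open import Defs hiding (sym; here; step)
open import Data.Nat
open import Data.Nat.Properties
open import Data.Nat.DivMod
open import Data.Nat.Induction using (<-rec)
open import Data.Nat.Tactic.RingSolver using (solve-∀)
open import Data.Bool using (true) renaming (_≟_ to _≟ᵇ_)
open import Data.Fin as Fin using (Fin; toℕ; fromℕ<)
open import Data.Fin.Properties using (toℕ-fromℕ<; fromℕ<-cong; toℕ-injective; toℕ<n; ¬∀⟶∃¬; all?; injective⇒≤)
import Data.Fin.Properties as FinP
open import Data.List using (List; []; _∷_; _++_; length; lookup; map; concatMap; allFin; cartesianProduct; filter)
open import Data.List.Relation.Unary.Any as Any using (here; there)
open import Data.List.Relation.Unary.Any.Properties using (lookup-index)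
import Data.List.Relation.Unary.All as All
open import Data.List.Relation.Unary.AllPairs using (_∷_)
open import Data.List.Relation.Unary.Unique.Propositional using (Unique)
open import Data.List.Relation.Unary.Unique.Propositional.Properties using (cartesianProduct⁺; allFin⁺; filter⁺)
open import Data.List.Membership.Propositional using (_∈_)
open import Data.List.Membership.Propositional.Properties using (∈-lookup; ∈-allFin; ∈-cartesianProduct⁺; ∈-filter⁺; ∈-filter⁻)
open import Data.Product using (Σ; ∃; ∃₂; _×_; _,_; proj₁; proj₂)
open import Data.Sum using (_⊎_; inj₁; inj₂)
open import Data.Empty
open import Relation.Binary.PropositionalEquality
open import Relation.Nullary
open import Relation.Binary.Definitions using (tri<; tri≈; tri>)
open import Function using (_∘_; const; case_of_)
open import Relation.Nullary.Decidable using (decidable-stable; _→-dec_; _⊎-dec_; _×-dec_)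

module Modular (K : ℕ) {{_ : NonZero K}} where

  infix 4 _≈_
  _≈_ : ℕ → ℕ → Set
  a ≈ b = a % K ≡ b % K

  ≈-sym : ∀ {a b} → a ≈ b → b ≈ a
  ≈-sym = sym

  ≈-trans : ∀ {a b c} → a ≈ b → b ≈ c → a ≈ c
  ≈-trans = trans

  ≡⇒≈ : ∀ {a b} → a ≡ b → a ≈ b
  ≡⇒≈ = cong (_% K)

  +-congʳ : ∀ {a b} c → a ≈ b → a + c ≈ b + c
  +-congʳ {a} {b} c a≈b = begin
    (a + c) % K          ≡⟨ %-distribˡ-+ a c K ⟩
    (a % K + c % K) % K  ≡⟨ cong (λ z → (z + c % K) % K) a≈b ⟩
    (b % K + c % K) % K  ≡⟨ %-distribˡ-+ b c K ⟨
    (b + c) % K          ∎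
    where open ≡-Reasoning

  +-congˡ : ∀ {a b} c → a ≈ b → c + a ≈ c + b
  +-congˡ {a} {b} c a≈b rewrite +-comm c a | +-comm c b = +-congʳ c a≈b

  %-≈ : ∀ a → a % K ≈ a
  %-≈ a = m%n%n≡m%n a K

  +K-≈ : ∀ a → a + K ≈ a
  +K-≈ a = [m+n]%n≡m%n a K

  K≈0 : K ≈ 0
  K≈0 = +K-≈ 0

  +-cancelʳ-≈ : ∀ {a b} c → a + c ≈ b + c → a ≈ b
  +-cancelʳ-≈ {a} {b} c a+c≈b+c =
    ≈-trans (≈-sym (complete a)) (≈-trans (+-congʳ (K ∸ c % K) reduced) (complete b))
    where
    complete : ∀ x → x + c % K + (K ∸ c % K) ≈ x
    complete x rewrite +-assoc x (c % K) (K ∸ c % K) | m+[n∸m]≡n (m%n≤n c K) = +K-≈ x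
    reduced : a + c % K ≈ b + c % K
    reduced = ≈-trans (+-congˡ a (%-≈ c)) (≈-trans a+c≈b+c (+-congˡ b (≈-sym (%-≈ c))))

  +-cancelˡ-≈ : ∀ {a b} c → c + a ≈ c + b → a ≈ b
  +-cancelˡ-≈ {a} {b} c e rewrite +-comm c a | +-comm c b = +-cancelʳ-≈ c e

  ≈⇒≡ : ∀ {a b} → a < K → b < K → a ≈ b → a ≡ b
  ≈⇒≡ a<K b<K a≈b = trans (sym (m<n⇒m%n≡m a<K)) (trans a≈b (m<n⇒m%n≡m b<K))

  offset : ∀ b y → ∃ λ r → r < K × b + r ≈ y
  offset b y = r , m%n<n _ K , b+r≈y
    where
    r = (y + (K ∸ b % K)) % K
    sum≡ : b % K + (y + (K ∸ b % K)) ≡ y + K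
    sum≡ = begin
      b % K + (y + (K ∸ b % K))  ≡⟨ cong (b % K +_) (+-comm y _) ⟩
      b % K + ((K ∸ b % K) + y)  ≡⟨ +-assoc (b % K) _ y ⟨
      (b % K + (K ∸ b % K)) + y  ≡⟨ cong (_+ y) (m+[n∸m]≡n (m%n≤n b K)) ⟩
      K + y                      ≡⟨ +-comm K y ⟩
      y + K                      ∎
      where open ≡-Reasoning
    b+r≈y : b + r ≈ y
    b+r≈y = ≈-trans (+-congˡ b (%-≈ _))
            (≈-trans (+-congʳ (y + (K ∸ b % K)) (≈-sym (%-≈ b)))
            (≈-trans (≡⇒≈ sum≡) (+K-≈ y)))

Adj-sym : ∀ {G : Graph} {u v} → Adj G u v → Adj G v u
Adj-sym {G} {u} {v} uv = trans (Graph.sym G v u) uv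

UnorderedEq : {A : Set} → A → A → A → A → Set
UnorderedEq a b u v = (a ≡ u × b ≡ v) ⊎ (a ≡ v × b ≡ u)

UnorderedEq-cong : ∀ {A : Set} {a b a′ b′ u v : A} → a′ ≡ a → b′ ≡ b →
  UnorderedEq a b u v → UnorderedEq a′ b′ u v
UnorderedEq-cong a′≡a b′≡b (inj₁ (a≡u , b≡v)) = inj₁ (trans a′≡a a≡u , trans b′≡b b≡v)
UnorderedEq-cong a′≡a b′≡b (inj₂ (a≡v , b≡u)) = inj₂ (trans a′≡a a≡v , trans b′≡b b≡u)

UnorderedEq-swap : ∀ {A : Set} {a b u v : A} → UnorderedEq a b u v → UnorderedEq b a u v
UnorderedEq-swap (inj₁ (a≡u , b≡v)) = inj₂ (b≡v , a≡u)
UnorderedEq-swap (inj₂ (a≡v , b≡u)) = inj₁ (b≡u , a≡v)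

UnorderedEq-sym : ∀ {A : Set} {a b u v : A} → UnorderedEq a b u v → UnorderedEq u v a b
UnorderedEq-sym (inj₁ (a≡u , b≡v)) = inj₁ (sym a≡u , sym b≡v)
UnorderedEq-sym (inj₂ (a≡v , b≡u)) = inj₂ (sym b≡u , sym a≡v)

UnorderedEq-trans : ∀ {A : Set} {a b u v x y : A} → UnorderedEq a b u v → UnorderedEq u v x y → UnorderedEq a b x y
UnorderedEq-trans (inj₁ (refl , refl)) uv = uv
UnorderedEq-trans (inj₂ (refl , refl)) uv = UnorderedEq-swap uv

InE-cong : ∀ {G : Graph} {C : Cycle G} {a b u v} → UnorderedEq a b u v → InE C u v → InE C a b
InE-cong ab≐uv (i , j , i→j , e) = i , j , i→j , UnorderedEq-trans e (UnorderedEq-sym ab≐uv)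

cycleFromSequence : {G : Graph} (f : ℕ → Fin (n G)) (m : ℕ) → 3 ≤ m →
  (∀ x y → x < m → y < m → f x ≡ f y → x ≡ y) →
  (∀ x → suc x < m → Adj G (f x) (f (suc x))) →
  Adj G (f (pred m)) (f 0) →
  Σ (Cycle G) λ C → len C ≡ m
cycleFromSequence {G} f m 3≤m f-inj f-adj f-close = C , refl
  where
  f-closed : ∀ i j → CycSucc m i j → Adj G (f (toℕ i)) (f (toℕ j))
  f-closed i j (inj₁ e) rewrite sym e = f-adj (toℕ i) (subst (λ z → suc z ≤ m) (sym e) (toℕ<n j))
  f-closed i j (inj₂ (e , j≡0)) rewrite j≡0 =
    subst (λ z → Adj G (f z) (f 0)) (cong pred (sym e)) f-close
  C : Cycle G
  C = record
    { len = m ; len≥3 = 3≤m ; vert = λ i → f (toℕ i)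
    ; inj = λ {i} {j} e → toℕ-injective (f-inj _ _ (toℕ<n i) (toℕ<n j) e)
    ; closed = f-closed }

-- Position x ∈ ℕ stands for the vertex of C with index x mod K.
module Periodic {G : Graph} (C : Cycle G) (K : ℕ) (len≡K : len C ≡ K) {{_ : NonZero K}} where
  open Modular K

  private
    %<len : ∀ x → x % K < len C
    %<len x = subst (x % K <_) (sym len≡K) (m%n<n x K)

    toℕ<K : ∀ (i : Fin (len C)) → toℕ i < K
    toℕ<K i = subst (toℕ i <_) len≡K (toℕ<n i)

  index : ℕ → Fin (len C)
  index x = fromℕ< (%<len x)

  toℕ-index : ∀ x → toℕ (index x) ≡ x % K
  toℕ-index x = toℕ-fromℕ< (%<len x)

  index-cong : ∀ {x y} → x ≈ y → index x ≡ index y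
  index-cong {x} {y} x≈y = fromℕ<-cong _ _ x≈y (%<len x) (%<len y)

  index-toℕ : ∀ (i : Fin (len C)) → index (toℕ i) ≡ i
  index-toℕ i = toℕ-injective (trans (toℕ-index (toℕ i)) (m<n⇒m%n≡m (toℕ<K i)))

  at : ℕ → Fin (n G)
  at x = vert C (index x)

  at-cong : ∀ {x y} → x ≈ y → at x ≡ at y
  at-cong x≈y = cong (vert C) (index-cong x≈y)

  at-injective : ∀ {x y} → at x ≡ at y → x ≈ y
  at-injective {x} {y} e = trans (sym (toℕ-index x)) (trans (cong toℕ (inj C e)) (toℕ-index y))

  at-toℕ : ∀ (i : Fin (len C)) → at (toℕ i) ≡ vert C i
  at-toℕ i = cong (vert C) (index-toℕ i)

  CycSucc-index : ∀ x → CycSucc (len C) (index x) (index (suc x))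
  CycSucc-index x with suc (x % K) <? K
  ... | yes sx%K<K = inj₁ (begin
    suc (toℕ (index x))  ≡⟨ cong suc (toℕ-index x) ⟩
    suc (x % K)          ≡⟨ m<n⇒m%n≡m sx%K<K ⟨
    suc (x % K) % K      ≡⟨ +-congˡ 1 (%-≈ x) ⟩
    suc x % K            ≡⟨ toℕ-index (suc x) ⟨
    toℕ (index (suc x))  ∎)
    where open ≡-Reasoning
  ... | no sx%K≮K = inj₂ (trans (cong suc (toℕ-index x)) (trans sx%K≡K (sym len≡K)) , toℕ-sx≡0)
    where
    sx%K≡K : suc (x % K) ≡ K
    sx%K≡K = ≤-antisym (m%n<n x K) (≮⇒≥ sx%K≮K)
    toℕ-sx≡0 : toℕ (index (suc x)) ≡ 0
    toℕ-sx≡0 = trans (toℕ-index (suc x))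
                 (trans (+-congˡ 1 (≈-sym (%-≈ x))) (trans (cong (_% K) sx%K≡K) (n%n≡0 K)))

  CycSucc⇒≈ : ∀ i j → CycSucc (len C) i j → toℕ j ≈ suc (toℕ i)
  CycSucc⇒≈ i j (inj₁ e) = cong (_% K) (sym e)
  CycSucc⇒≈ i j (inj₂ (e , j≡0)) = trans (cong (_% K) j≡0) (sym (trans (cong (_% K) (trans e len≡K)) K≈0))

  at-adj : ∀ x → Adj G (at x) (at (suc x))
  at-adj x = closed C (index x) (index (suc x)) (CycSucc-index x)

  at-adj+ : ∀ b x → Adj G (at (b + x)) (at (b + suc x))
  at-adj+ b x = subst (λ z → Adj G (at (b + x)) (at z)) (sym (+-suc b x)) (at-adj (b + x))

  at-injective+ : ∀ b {x y} → x < K → y < K → at (b + x) ≡ at (b + y) → x ≡ y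
  at-injective+ b x<K y<K e = ≈⇒≡ x<K y<K (+-cancelˡ-≈ b (at-injective e))

  InV⇒at : ∀ {v} → InV C v → ∃ λ x → x < K × at x ≡ v
  InV⇒at (i , e) = toℕ i , toℕ<K i , trans (at-toℕ i) e

  at⇒InV : ∀ {x v} → at x ≡ v → InV C v
  at⇒InV {x} e = index x , e

  EdgeAt : ℕ → Fin (n G) → Fin (n G) → Set
  EdgeAt x = UnorderedEq (at x) (at (suc x))

  InE⇒EdgeAt : ∀ {u v} → InE C u v → ∃ λ x → x < K × EdgeAt x u v
  InE⇒EdgeAt (i , j , i→j , e) = toℕ i , toℕ<K i , UnorderedEq-cong (at-toℕ i) at-si≡j e
    where
    at-si≡j : at (suc (toℕ i)) ≡ vert C j
    at-si≡j = trans (at-cong (≈-sym (CycSucc⇒≈ i j i→j))) (at-toℕ j)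

  EdgeAt⇒InE : ∀ {x u v} → EdgeAt x u v → InE C u v
  EdgeAt⇒InE {x} e = index x , index (suc x) , CycSucc-index x , e

  EdgeAt-cong : ∀ {x y u v} → x ≈ y → EdgeAt x u v → EdgeAt y u v
  EdgeAt-cong x≈y = UnorderedEq-cong (at-cong (≈-sym x≈y)) (at-cong (≈-sym (+-congˡ 1 x≈y)))

  arcCycle : ∀ b d → 2 ≤ d → d < K → Adj G (at (b + d)) (at b) → Σ (Cycle G) λ D → len D ≡ suc d
  arcCycle b d 2≤d d<K chord =
    cycleFromSequence (λ x → at (b + x)) (suc d) (s≤s 2≤d) arc-inj (λ x _ → at-adj+ b x) arc-close
    where
    arc-inj : ∀ x y → x < suc d → y < suc d → at (b + x) ≡ at (b + y) → x ≡ y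
    arc-inj x y x≤d y≤d = at-injective+ b (≤-<-trans (≤-pred x≤d) d<K) (≤-<-trans (≤-pred y≤d) d<K)
    arc-close : Adj G (at (b + d)) (at (b + 0))
    arc-close = subst (λ z → Adj G (at (b + d)) (at z)) (sym (+-identityʳ b)) chord

module Gluing {G : Graph} (p r : ℕ → Fin (n G)) (lp lr : ℕ) (1≤lp : 1 ≤ lp) (1≤lr : 1 ≤ lr)
  (3≤lp+lr : 3 ≤ lp + lr)
  (p-inj : ∀ x y → x < lp → y < lp → p x ≡ p y → x ≡ y)
  (r-inj : ∀ x y → x < lr → y < lr → r x ≡ r y → x ≡ y)
  (disjoint : ∀ x y → x < lp → y < lr → p x ≢ r y)
  (p-adj : ∀ x → x < lp → Adj G (p x) (p (suc x)))
  (r-adj : ∀ y → y < lr → Adj G (r y) (r (suc y)))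
  (p-end : p lp ≡ r 0) (r-end : r lr ≡ p 0) where

  private
    f : ℕ → Fin (n G)
    f x with x <? lp
    ... | yes _ = p x
    ... | no _ = r (x ∸ lp)

    f-< : ∀ {x} → x < lp → f x ≡ p x
    f-< {x} x<lp with x <? lp
    ... | yes _ = refl
    ... | no x≮lp = ⊥-elim (x≮lp x<lp)

    f-≥ : ∀ {x} → lp ≤ x → f x ≡ r (x ∸ lp)
    f-≥ {x} lp≤x with x <? lp
    ... | yes x<lp = ⊥-elim (<⇒≱ x<lp lp≤x)
    ... | no _ = refl

    ∸lp< : ∀ {x} → lp ≤ x → x < lp + lr → x ∸ lp < lr
    ∸lp< {x} lp≤x x<M = +-cancelˡ-< lp _ _ (subst (_< lp + lr) (sym (m+[n∸m]≡n lp≤x)) x<M)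

    f-inj : ∀ x y → x < lp + lr → y < lp + lr → f x ≡ f y → x ≡ y
    f-inj x y x<M y<M fx≡fy with x <? lp | y <? lp
    ... | yes x<lp | yes y<lp = p-inj x y x<lp y<lp fx≡fy
    ... | yes x<lp | no y≮lp = ⊥-elim (disjoint x (y ∸ lp) x<lp (∸lp< (≮⇒≥ y≮lp) y<M) fx≡fy)
    ... | no x≮lp | yes y<lp = ⊥-elim (disjoint y (x ∸ lp) y<lp (∸lp< (≮⇒≥ x≮lp) x<M) (sym fx≡fy))
    ... | no x≮lp | no y≮lp = begin
      x               ≡⟨ m+[n∸m]≡n (≮⇒≥ x≮lp) ⟨
      lp + (x ∸ lp)   ≡⟨ cong (lp +_) (r-inj _ _ (∸lp< (≮⇒≥ x≮lp) x<M) (∸lp< (≮⇒≥ y≮lp) y<M) fx≡fy) ⟩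
      lp + (y ∸ lp)   ≡⟨ m+[n∸m]≡n (≮⇒≥ y≮lp) ⟩
      y               ∎
      where open ≡-Reasoning

    f-adj : ∀ x → suc x < lp + lr → Adj G (f x) (f (suc x))
    f-adj x sx<M with x <? lp | suc x <? lp
    ... | yes x<lp | yes _ = p-adj x x<lp
    ... | yes x<lp | no sx≮lp = subst (Adj G (p x)) r0≡ (p-adj x x<lp)
      where
      sx≡lp : suc x ≡ lp
      sx≡lp = ≤-antisym x<lp (≮⇒≥ sx≮lp)
      r0≡ : p (suc x) ≡ r (suc x ∸ lp)
      r0≡ = trans (cong p sx≡lp) (trans p-end (cong r (sym (trans (cong (_∸ lp) sx≡lp) (n∸n≡0 lp)))))
    ... | no x≮lp | yes sx<lp = ⊥-elim (x≮lp (<-trans (n<1+n x) sx<lp))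
    ... | no x≮lp | no _ = subst (Adj G (r (x ∸ lp))) (cong r (sym (+-∸-assoc 1 (≮⇒≥ x≮lp))))
                             (r-adj (x ∸ lp) (∸lp< (≮⇒≥ x≮lp) (<-trans (n<1+n x) sx<M)))

    f-close : Adj G (f (pred (lp + lr))) (f 0)
    f-close = subst₂ (Adj G) (sym (trans (f-≥ lp≤last) (cong r last∸lp))) (sym (f-< 1≤lp))
                (subst (Adj G (r (pred lr))) (trans (cong r (suc-pred lr)) r-end)
                  (r-adj (pred lr) (pred< 1≤lr)))
      where
      instance
        _ : NonZero lr
        _ = >-nonZero 1≤lr
      pred< : ∀ {m} → 1 ≤ m → pred m < m
      pred< {suc m} _ = n<1+n m
      last≡ : pred (lp + lr) ≡ lp + pred lr
      last≡ = +-∸-assoc lp {lr} {1} 1≤lr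
      lp≤last : lp ≤ pred (lp + lr)
      lp≤last = subst (lp ≤_) (sym last≡) (m≤m+n lp _)
      last∸lp : pred (lp + lr) ∸ lp ≡ pred lr
      last∸lp = trans (cong (_∸ lp) last≡) (m+n∸m≡n lp (pred lr))

  gluedCycle : Σ (Cycle G) λ C → len C ≡ lp + lr
  gluedCycle = cycleFromSequence f (lp + lr) 3≤lp+lr f-inj f-adj f-close

IsInduced : {G : Graph} → Cycle G → Set
IsInduced {G} C = ∀ i j → Adj G (vert C i) (vert C j) → CycSucc (len C) i j ⊎ CycSucc (len C) j i

record ChordSplit {G : Graph} (C : Cycle G) : Set where
  field
    left right : Cycle G
    len-sum    : len left + len right ≡ len C + 2

  left<len : len left < len C
  left<len = +-cancelʳ-≤ 2 (suc (len left)) (len C) (begin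
    suc (len left) + 2   ≡⟨ +-comm (suc (len left)) 2 ⟩
    3 + len left         ≡⟨ +-comm 3 (len left) ⟩
    len left + 3         ≤⟨ +-monoʳ-≤ (len left) (len≥3 right) ⟩
    len left + len right ≡⟨ len-sum ⟩
    len C + 2            ∎)
    where open ≤-Reasoning

module _ {G : Graph} (C : Cycle G) where
  private
    L = len C
    instance
      _ : NonZero L
      _ = >-nonZero (≤-trans (s≤s z≤n) (len≥3 C))
  open Modular L
  open Periodic C L refl

  private
    chord-gap : ∀ i j → Adj G (vert C i) (vert C j) → ¬ CycSucc L i j →
                ∀ d → toℕ i + d ≈ toℕ j → 2 ≤ d
    chord-gap i j ij ¬i→j zero i+0≈j = ⊥-elim (loop (Adj-sym {G} (subst (λ z → Adj G (vert C z) (vert C j)) i≡j ij)))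
      where
      i≡j : i ≡ j
      i≡j = trans (sym (index-toℕ i)) (trans (index-cong (subst (_≈ toℕ j) (+-identityʳ (toℕ i)) i+0≈j)) (index-toℕ j))
      loop : ¬ Adj G (vert C j) (vert C j)
      loop jj = case trans (sym jj) (irrefl G (vert C j)) of λ ()
    chord-gap i j ij ¬i→j (suc zero) i+1≈j = ⊥-elim (¬i→j (subst₂ (CycSucc L) (index-toℕ i) i+1 (CycSucc-index (toℕ i))))
      where
      i+1 : index (suc (toℕ i)) ≡ j
      i+1 = trans (index-cong (subst (_≈ toℕ j) (+-comm (toℕ i) 1) i+1≈j)) (index-toℕ j)
    chord-gap _ _ _ _ (suc (suc _)) _ = s≤s (s≤s z≤n)

  splitAtChord : ∀ i j → Adj G (vert C i) (vert C j) → ¬ (CycSucc L i j ⊎ CycSucc L j i) → ChordSplit C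
  splitAtChord i j ij ¬edge = record
    { left = proj₁ arc-ij ; right = proj₁ arc-ji
    ; len-sum = trans (cong₂ _+_ (proj₂ arc-ij) (proj₂ arc-ji)) sum≡ }
    where
    a = toℕ i
    b = toℕ j
    off = offset a b
    d = proj₁ off
    d<L = proj₁ (proj₂ off)
    a+d≈b = proj₂ (proj₂ off)
    e = L ∸ d
    d+e≡L : d + e ≡ L
    d+e≡L = m+[n∸m]≡n (<⇒≤ d<L)
    b+e≈a : b + e ≈ a
    b+e≈a = ≈-trans (+-congʳ e (≈-sym a+d≈b))
              (≈-trans (≡⇒≈ (trans (+-assoc a d e) (cong (a +_) d+e≡L))) (+K-≈ a))
    2≤d : 2 ≤ d
    2≤d = chord-gap i j ij (¬edge ∘ inj₁) d a+d≈b
    2≤e : 2 ≤ e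
    2≤e = chord-gap j i (Adj-sym {G} ij) (¬edge ∘ inj₂) e b+e≈a
    e<L : e < L
    e<L = ∸-monoʳ-< {L} {d} {0} (≤-trans (s≤s z≤n) 2≤d) (<⇒≤ d<L)
    arc-ij = arcCycle a d 2≤d d<L (subst₂ (Adj G) (sym (trans (at-cong a+d≈b) (at-toℕ j))) (sym (at-toℕ i)) (Adj-sym {G} ij))
    arc-ji = arcCycle b e 2≤e e<L (subst₂ (Adj G) (sym (trans (at-cong b+e≈a) (at-toℕ i))) (sym (at-toℕ j)) ij)
    sum≡ : suc d + suc e ≡ L + 2
    sum≡ = begin
      suc d + suc e      ≡⟨ cong suc (+-suc d e) ⟩
      suc (suc (d + e))  ≡⟨ cong (suc ∘ suc) d+e≡L ⟩
      2 + L              ≡⟨ +-comm 2 L ⟩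
      L + 2              ∎
      where open ≡-Reasoning

  private
    Chordless : Fin L → Fin L → Set
    Chordless i j = Adj G (vert C i) (vert C j) → CycSucc L i j ⊎ CycSucc L j i

    chordless? : ∀ i j → Dec (Chordless i j)
    chordless? i j = (adj G (vert C i) (vert C j) ≟ᵇ true) →-dec (cycSucc? L i j ⊎-dec cycSucc? L j i)

    chord : ∀ i j → ¬ Chordless i j → ChordSplit C
    chord i j ¬chordless with adj G (vert C i) (vert C j) ≟ᵇ true
    ... | yes ij = splitAtChord i j ij (¬chordless ∘ const)
    ... | no ¬ij = ⊥-elim (¬chordless (⊥-elim ∘ ¬ij))

  inducedOrSplit : IsInduced C ⊎ ChordSplit C
  inducedOrSplit with all? (λ i → all? (chordless? i))
  ... | yes induced = inj₁ induced
  ... | no ¬induced =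
    let (i , ¬row) = ¬∀⟶∃¬ L _ (λ i → all? (chordless? i)) ¬induced
        (j , ¬ij) = ¬∀⟶∃¬ L _ (chordless? i) ¬row
    in inj₂ (chord i j ¬ij)

module ChordalityBounds {G : Graph} (k : ℕ) (induced≡k : ∀ (C : InducedCycle G) → len (cyc C) ≡ k) where

  private
    induced-len : ∀ (C : Cycle G) → IsInduced C → len C ≡ k
    induced-len C ind = induced≡k (record { cyc = C ; induced = ind })

  k≤len : ∀ (C : Cycle G) → k ≤ len C
  k≤len C = <-rec (λ m → ∀ (C : Cycle G) → len C ≡ m → k ≤ m) shorter (len C) C refl
    where
    shorter : ∀ m → (∀ {m′} → m′ < m → ∀ (C : Cycle G) → len C ≡ m′ → k ≤ m′) → ∀ (C : Cycle G) → len C ≡ m → k ≤ m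
    shorter m rec C refl with inducedOrSplit C
    ... | inj₁ ind = ≤-reflexive (sym (induced-len C ind))
    ... | inj₂ split = <⇒≤ (≤-<-trans (rec left<len left refl) left<len)
      where open ChordSplit split

  len+4≤2k⇒len≡k : ∀ (C : Cycle G) → len C + 4 ≤ k + k → len C ≡ k
  len+4≤2k⇒len≡k C len+4≤2k with inducedOrSplit C
  ... | inj₁ ind = induced-len C ind
  ... | inj₂ split = ⊥-elim (<⇒≱ (+-monoʳ-< (len C) (n<1+n 3)) (begin
    len C + 4  ≤⟨ len+4≤2k ⟩
    k + k      ≤⟨ subst (k + k ≤_) len-sum (+-mono-≤ (k≤len left) (k≤len right)) ⟩
    len C + 2  ≤⟨ +-monoʳ-≤ (len C) (n≤1+n 2) ⟩
    len C + 3  ∎))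
    where
    open ChordSplit split
    open ≤-Reasoning

module _ {P : ℕ → Set} (P? : ∀ m → Dec (P m)) where

  private
    search : ∀ m → (∃ λ l → l < m × P l × (∀ j → j < l → ¬ P j)) ⊎ (∀ j → j < m → ¬ P j)
    search zero = inj₂ λ _ ()
    search (suc m) with search m
    ... | inj₁ (l , l<m , pl , below) = inj₁ (l , m<n⇒m<1+n l<m , pl , below)
    ... | inj₂ none with P? m
    ...   | yes pm = inj₁ (m , n<1+n m , pm , none)
    ...   | no ¬pm = inj₂ λ j j<1+m → case m≤n⇒m<n∨m≡n (≤-pred j<1+m) of λ
                       { (inj₁ j<m) → none j j<m
                       ; (inj₂ refl) → ¬pm }

  least : ∀ m → P m → ∃ λ l → l ≤ m × P l × (∀ j → j < l → ¬ P j)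
  least m pm with search m
  ... | inj₁ (l , l<m , pl , below) = l , <⇒≤ l<m , pl , below
  ... | inj₂ none = m , ≤-refl , pm , none

≤-extend : ∀ {D : ℕ → Set} ℓ → (∀ x → x ≤ ℓ → D x) → D (suc ℓ) → ∀ x → x ≤ suc ℓ → D x
≤-extend {D} ℓ below next x x≤1+ℓ with m≤n⇒m<n∨m≡n x≤1+ℓ
... | inj₁ x<1+ℓ = below x (≤-pred x<1+ℓ)
... | inj₂ refl = next

halves-tight : ∀ k q q′ d → k ≤ q + q → k ≤ q′ + q′ → q′ + (q + d) ≤ k → d ≡ 0 × q′ + q ≡ k
halves-tight k q q′ d k≤2q k≤2q′ q′+q+d≤k = d≡0 , ≤-antisym q′+q≤k k≤q′+q
  where
  X = (q + q) + (q′ + q′)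
  regroup₁ : ∀ q q′ d → (q′ + (q + d)) + (q′ + (q + d)) ≡ ((q + q) + (q′ + q′)) + (d + d)
  regroup₁ = solve-∀
  regroup₂ : ∀ q q′ → (q + q) + (q′ + q′) ≡ (q′ + q) + (q′ + q)
  regroup₂ = solve-∀
  X+2d≤X : X + (d + d) ≤ X + 0
  X+2d≤X = subst₂ _≤_ (regroup₁ q q′ d) (sym (+-identityʳ X))
             (≤-trans (+-mono-≤ q′+q+d≤k q′+q+d≤k) (+-mono-≤ k≤2q k≤2q′))
  d≡0 : d ≡ 0
  d≡0 = m+n≡0⇒m≡0 d (n≤0⇒n≡0 (+-cancelˡ-≤ X _ _ X+2d≤X))
  q′+q≤k : q′ + q ≤ k
  q′+q≤k = subst (λ z → q′ + z ≤ k) (trans (cong (q +_) d≡0) (+-identityʳ q)) q′+q+d≤k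
  k≤q′+q : k ≤ q′ + q
  k≤q′+q = +-cancelʳ-≤ k k (q′ + q) (begin
    k + k                  ≤⟨ +-mono-≤ k≤2q k≤2q′ ⟩
    (q + q) + (q′ + q′)    ≡⟨ regroup₂ q q′ ⟩
    (q′ + q) + (q′ + q)    ≤⟨ +-monoʳ-≤ (q′ + q) q′+q≤k ⟩
    (q′ + q) + k           ∎)
    where open ≤-Reasoning

∸≡suc∸suc : ∀ {a y} → y < a → a ∸ y ≡ suc (a ∸ suc y)
∸≡suc∸suc {suc a} {zero} _ = refl
∸≡suc∸suc {suc a} {suc y} (s≤s y<a) = ∸≡suc∸suc y<a

2+≤-if-distinct : ∀ q e₁ e₂ k → q ≤ e₁ → q ≤ e₂ → e₁ < k → e₂ < k → e₁ ≢ e₂ → 2 + q ≤ k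
2+≤-if-distinct q e₁ e₂ k q≤e₁ q≤e₂ e₁<k e₂<k e₁≢e₂ with <-cmp e₁ e₂
... | tri< e₁<e₂ _ _ = ≤-trans (s≤s (≤-trans (s≤s q≤e₁) e₁<e₂)) e₂<k
... | tri≈ _ e₁≡e₂ _ = ⊥-elim (e₁≢e₂ e₁≡e₂)
... | tri> _ _ e₂<e₁ = ≤-trans (s≤s (≤-trans (s≤s q≤e₂) e₂<e₁)) e₁<k

lookup-injective : ∀ {A : Set} {xs : List A} → Unique xs → ∀ {i j} → lookup xs i ≡ lookup xs j → i ≡ j
lookup-injective {xs = _ ∷ _} (_ ∷ _) {Fin.zero} {Fin.zero} _ = refl
lookup-injective {xs = _ ∷ _} (x∉ ∷ _) {Fin.zero} {Fin.suc j} e = ⊥-elim (All.lookup x∉ (∈-lookup j) e)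
lookup-injective {xs = _ ∷ _} (x∉ ∷ _) {Fin.suc i} {Fin.zero} e = ⊥-elim (All.lookup x∉ (∈-lookup i) (sym e))
lookup-injective {xs = _ ∷ _} (_ ∷ u) {Fin.suc i} {Fin.suc j} e = cong Fin.suc (lookup-injective u e)

length-enumerated : ∀ {A : Set} (xs : List A) → Unique xs → (m : ℕ) (g : Fin m → A) →
  (∀ {d d′} → g d ≡ g d′ → d ≡ d′) → (∀ d → g d ∈ xs) → (∀ x → x ∈ xs → ∃ λ d → g d ≡ x) →
  length xs ≡ m
length-enumerated xs unique m g g-inj g∈ onto = ≤-antisym (injective⇒≤ preimage-inj) (injective⇒≤ position-inj)
  where
  position : Fin m → Fin (length xs)
  position d = Any.index (g∈ d)
  position-inj : ∀ {d d′} → position d ≡ position d′ → d ≡ d′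
  position-inj {d} {d′} e = g-inj (trans (lookup-index (g∈ d)) (trans (cong (lookup xs) e) (sym (lookup-index (g∈ d′)))))
  preimage : Fin (length xs) → Fin m
  preimage j = proj₁ (onto (lookup xs j) (∈-lookup j))
  preimage-inj : ∀ {j j′} → preimage j ≡ preimage j′ → j ≡ j′
  preimage-inj {j} {j′} e = lookup-injective unique
    (trans (sym (proj₂ (onto _ (∈-lookup j)))) (trans (cong g e) (proj₂ (onto _ (∈-lookup j′)))))

two-distinct-members : ∀ {A : Set} (xs : List A) → 2 ≤ length xs → Unique xs → ∃₂ λ x y → x ∈ xs × y ∈ xs × x ≢ y
two-distinct-members (x ∷ y ∷ _) _ (x∉ ∷ _) = x , y , here refl , there (here refl) , All.head x∉
two-distinct-members (_ ∷ []) (s≤s ()) _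

allPairs≡cartesianProduct : ∀ m → allPairs m ≡ cartesianProduct (allFin m) (allFin m)
allPairs≡cartesianProduct m = go (allFin m)
  where
  go : ∀ xs → concatMap (λ u → map (u ,_) (allFin m)) xs ≡ cartesianProduct xs (allFin m)
  go [] = refl
  go (x ∷ xs) = cong (map (x ,_) (allFin m) ++_) (go xs)

∈-allPairs : ∀ {m} (p : Fin m × Fin m) → p ∈ allPairs m
∈-allPairs {m} (u , v) = subst ((u , v) ∈_) (sym (allPairs≡cartesianProduct m)) (∈-cartesianProduct⁺ (∈-allFin u) (∈-allFin v))

allPairs-unique : ∀ m → Unique (allPairs m)
allPairs-unique m = subst Unique (sym (allPairs≡cartesianProduct m)) (cartesianProduct⁺ (allFin⁺ m) (allFin⁺ m))

module _ {m : ℕ} where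

  sortPair : Fin m → Fin m → Fin m × Fin m
  sortPair a b with a Fin.≤? b
  ... | yes _ = a , b
  ... | no _ = b , a

  sortPair-cases : ∀ a b → UnorderedEq a b (proj₁ (sortPair a b)) (proj₂ (sortPair a b))
  sortPair-cases a b with a Fin.≤? b
  ... | yes _ = inj₁ (refl , refl)
  ... | no _ = inj₂ (refl , refl)

  sortPair-< : ∀ a b → a ≢ b → proj₁ (sortPair a b) Fin.< proj₂ (sortPair a b)
  sortPair-< a b a≢b with a Fin.≤? b
  ... | yes a≤b = FinP.≤∧≢⇒< a≤b a≢b
  ... | no a≰b = ≰⇒> a≰b

  sortPair-sorted : ∀ {u v} a b → u Fin.< v → UnorderedEq a b u v → sortPair a b ≡ (u , v)
  sortPair-sorted a b u<v (inj₁ (refl , refl)) with a Fin.≤? b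
  ... | yes _ = refl
  ... | no a≰b = ⊥-elim (a≰b (<⇒≤ u<v))
  sortPair-sorted a b u<v (inj₂ (refl , refl)) with a Fin.≤? b
  ... | yes a≤b = ⊥-elim (<⇒≱ u<v a≤b)
  ... | no _ = refl

  sortPair-injective : ∀ {a b a′ b′} → sortPair a b ≡ sortPair a′ b′ → UnorderedEq a b a′ b′
  sortPair-injective {a} {b} {a′} {b′} e =
    UnorderedEq-trans (subst (λ p → UnorderedEq a b (proj₁ p) (proj₂ p)) e (sortPair-cases a b))
                      (UnorderedEq-sym (sortPair-cases a′ b′))

module TwoCycles {G : Graph} (k : ℕ) (induced≡k : ∀ (C : InducedCycle G) → len (cyc C) ≡ k)
                 (Si Sj : InducedCycle G) where

  3≤k : 3 ≤ k
  3≤k = subst (3 ≤_) (induced≡k Si) (len≥3 (cyc Si))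

  instance
    _ : NonZero k
    _ = >-nonZero (≤-trans (s≤s z≤n) 3≤k)

  open Modular k
  open ChordalityBounds k induced≡k

  Ci Cj : Cycle G
  Ci = cyc Si
  Cj = cyc Sj

  module I = Periodic Ci k (induced≡k Si)
  module J = Periodic Cj k (induced≡k Sj)

  s t : ℕ → Fin (n G)
  s = I.at
  t = J.at

  OnJ : Fin (n G) → Set
  OnJ = InV Cj

  Shared : ℕ → Set
  Shared x = InE Cj (s x) (s (suc x))

  shared? : ∀ x → Dec (Shared x)
  shared? x = inE? Cj _ _

  Shared-cong : ∀ {x y} → x ≈ y → Shared x → Shared y
  Shared-cong x≈y = subst₂ (InE Cj) (I.at-cong x≈y) (I.at-cong (+-congˡ 1 x≈y))

  Shared⇒OnJ : ∀ {x} → Shared x → OnJ (s x) × OnJ (s (suc x))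
  Shared⇒OnJ (i , j , _ , inj₁ (i≡ , j≡)) = (i , i≡) , (j , j≡)
  Shared⇒OnJ (i , j , _ , inj₂ (i≡ , j≡)) = (j , j≡) , (i , i≡)

  OnJ⇒Shared : ∀ {x} → OnJ (s x) → OnJ (s (suc x)) → Shared x
  OnJ⇒Shared {x} (i , i≡) (j , j≡) with induced Sj i j (subst₂ (Adj G) (sym i≡) (sym j≡) (I.at-adj x))
  ... | inj₁ i→j = i , j , i→j , inj₁ (i≡ , j≡)
  ... | inj₂ j→i = j , i , j→i , inj₂ (j≡ , i≡)

  ≉+2 : ∀ z → ¬ (z ≈ z + 2)
  ≉+2 z z≈z+2 = case ≈⇒≡ (≤-trans (s≤s z≤n) 3≤k) 3≤k (+-cancelˡ-≈ z (subst (_≈ z + 2) (sym (+-identityʳ z)) z≈z+2)) of λ ()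

  record Ear (i : ℕ) : Set where
    field
      q             : ℕ
      2≤q           : 2 ≤ q
      q<k           : q < k
      start-onJ     : OnJ (s i)
      end-onJ       : OnJ (s (i + q))
      interior-offJ : ∀ e → 0 < e → e < q → ¬ OnJ (s (i + e))
      unshared      : ∀ e → e < q → ¬ Shared (i + e)

  ear : ∀ i x → OnJ (s i) → ¬ Shared i → Shared x → Ear i
  ear i x start ¬shared-i shared-x = record
    { q = q ; 2≤q = 2≤q ; q<k = q<k ; start-onJ = start ; end-onJ = end
    ; interior-offJ = interior ; unshared = unshared }
    where
    OnJAfter : ℕ → Set
    OnJAfter e = OnJ (s (i + suc e))
    back-at-start : OnJAfter (pred k)
    back-at-start = subst OnJ (sym (trans (cong (λ z → s (i + z)) (suc-pred k)) (I.at-cong (+K-≈ i)))) start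
    first = least (λ e → inV? Cj (s (i + suc e))) (pred k) back-at-start
    e₀ = proj₁ first
    q = suc e₀
    end : OnJ (s (i + q))
    end = proj₁ (proj₂ (proj₂ first))
    interior : ∀ e → 0 < e → e < q → ¬ OnJ (s (i + e))
    interior (suc e) _ e<q = proj₂ (proj₂ (proj₂ first)) e (≤-pred e<q)
    unshared : ∀ e → e < q → ¬ Shared (i + e)
    unshared zero _ shared = ¬shared-i (subst Shared (+-identityʳ i) shared)
    unshared (suc e) e<q shared = interior (suc e) (s≤s z≤n) e<q (proj₁ (Shared⇒OnJ shared))
    e₀≢0 : e₀ ≢ 0
    e₀≢0 e₀≡0 = ¬shared-i (OnJ⇒Shared start (subst (λ z → OnJ (s z)) (+-comm i 1) (subst OnJAfter e₀≡0 end)))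
    2≤q : 2 ≤ q
    2≤q = s≤s (n≢0⇒n>0 e₀≢0)
    q≢k : q ≢ k
    q≢k q≡k = unshared r (subst (r <_) (sym q≡k) r<k) (Shared-cong (≈-sym i+r≈x) shared-x)
      where
      off = offset i x
      r = proj₁ off
      r<k = proj₁ (proj₂ off)
      i+r≈x = proj₂ (proj₂ off)
    q<k : q < k
    q<k = ≤∧≢⇒< (subst (q ≤_) (suc-pred k) (s≤s (proj₁ (proj₂ first)))) q≢k

  -- With α, β the positions on Sj of the ends of the ear, the ear closes into a cycle with
  -- either arc of Sj between them: backwards from β to α (a edges) or forwards (k ∸ a edges).
  module EarCycles {i : ℕ} (E : Ear i) where
    open Ear E

    α β a : ℕ
    α = proj₁ (J.InV⇒at start-onJ)
    β = proj₁ (J.InV⇒at end-onJ)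
    a = proj₁ (offset α β)

    tα≡ : t α ≡ s i
    tα≡ = proj₂ (proj₂ (J.InV⇒at start-onJ))

    tβ≡ : t β ≡ s (i + q)
    tβ≡ = proj₂ (proj₂ (J.InV⇒at end-onJ))

    a<k : a < k
    a<k = proj₁ (proj₂ (offset α β))

    α+a≈β : α + a ≈ β
    α+a≈β = proj₂ (proj₂ (offset α β))

    private
      p : ℕ → Fin (n G)
      p x = s (i + x)

      p0≡ : s i ≡ p 0
      p0≡ = cong s (sym (+-identityʳ i))

      p-inj : ∀ x y → x < q → y < q → p x ≡ p y → x ≡ y
      p-inj x y x<q y<q = I.at-injective+ i (<-trans x<q q<k) (<-trans y<q q<k)

      p-adj : ∀ x → x < q → Adj G (p x) (p (suc x))
      p-adj x _ = I.at-adj+ i x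

      1≤q : 1 ≤ q
      1≤q = ≤-trans (s≤s z≤n) 2≤q

      0<a : 0 < a
      0<a = n≢0⇒n>0 a≢0
        where
        a≢0 : a ≢ 0
        a≢0 a≡0 = <⇒≢ 1≤q (I.at-injective+ i (≤-trans (s≤s z≤n) q<k) q<k
                                 (trans (sym p0≡) (trans (sym tα≡) (trans tα≡tβ tβ≡))))
          where
          tα≡tβ : t α ≡ t β
          tα≡tβ = J.at-cong (≈-trans (≡⇒≈ (sym (+-identityʳ α))) (subst (λ z → α + z ≈ β) a≡0 α+a≈β))

      r : ℕ → Fin (n G)
      r y = t (β + y)

      r-inj : ∀ x y → x < k ∸ a → y < k ∸ a → r x ≡ r y → x ≡ y
      r-inj x y x< y< = J.at-injective+ β (≤-trans x< (m∸n≤m k a)) (≤-trans y< (m∸n≤m k a))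

      r-disjoint : ∀ x y → x < q → y < k ∸ a → p x ≢ r y
      r-disjoint zero y _ y< p0≡ry = <⇒≢ (≤-trans 0<a (m≤n+m a y)) (≈⇒≡ (≤-trans (s≤s z≤n) 3≤k) y+a<k 0≈y+a)
        where
        α≈β+y : α ≈ β + y
        α≈β+y = J.at-injective (trans tα≡ (trans p0≡ p0≡ry))
        y+a<k : y + a < k
        y+a<k = subst (y + a <_) (m∸n+n≡m (<⇒≤ a<k)) (+-monoˡ-< a y<)
        0≈y+a : 0 ≈ y + a
        0≈y+a = +-cancelˡ-≈ β (≈-trans (≡⇒≈ (+-identityʳ β))
                  (≈-trans (≈-sym α+a≈β) (≈-trans (+-congʳ a α≈β+y) (≡⇒≈ (+-assoc β y a)))))
      r-disjoint (suc x) y x< _ e = interior-offJ (suc x) (s≤s z≤n) x< (J.at⇒InV (sym e))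

      r-end : r (k ∸ a) ≡ p 0
      r-end = trans (J.at-cong β+k∸a≈α) (trans tα≡ p0≡)
        where
        β+k∸a≈α : β + (k ∸ a) ≈ α
        β+k∸a≈α = ≈-trans (+-congʳ (k ∸ a) (≈-sym α+a≈β))
                    (≈-trans (≡⇒≈ (trans (+-assoc α a _) (cong (α +_) (m+[n∸m]≡n (<⇒≤ a<k))))) (+K-≈ α))

      r′ : ℕ → Fin (n G)
      r′ y = t (α + (a ∸ y))

      r′-inj : ∀ x y → x < a → y < a → r′ x ≡ r′ y → x ≡ y
      r′-inj x y x<a y<a e = ∸-cancelˡ-≡ (<⇒≤ x<a) (<⇒≤ y<a)
        (J.at-injective+ α (≤-<-trans (m∸n≤m a x) a<k) (≤-<-trans (m∸n≤m a y) a<k) e)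

      r′-adj : ∀ y → y < a → Adj G (r′ y) (r′ (suc y))
      r′-adj y y<a = Adj-sym {G} (subst (λ z → Adj G (t (α + (a ∸ suc y))) (t (α + z)))
                                   (sym (∸≡suc∸suc y<a)) (J.at-adj+ α (a ∸ suc y)))

      r′-disjoint : ∀ x y → x < q → y < a → p x ≢ r′ y
      r′-disjoint zero y _ y<a p0≡r′y =
        <⇒≢ (m<n⇒0<n∸m y<a) (≈⇒≡ (≤-trans (s≤s z≤n) 3≤k) (≤-<-trans (m∸n≤m a y) a<k)
          (+-cancelˡ-≈ α (≈-trans (≡⇒≈ (+-identityʳ α)) (J.at-injective (trans tα≡ (trans p0≡ p0≡r′y))))))
      r′-disjoint (suc x) y x< _ e = interior-offJ (suc x) (s≤s z≤n) x< (J.at⇒InV (sym e))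

      r′-end : r′ a ≡ p 0
      r′-end = trans (cong t (trans (cong (α +_) (n∸n≡0 a)) (+-identityʳ α))) (trans tα≡ p0≡)

    forwardCycle : Σ (Cycle G) λ D → len D ≡ q + (k ∸ a)
    forwardCycle = Gluing.gluedCycle p r q (k ∸ a) 1≤q (m<n⇒0<n∸m a<k) (+-mono-≤ 2≤q (m<n⇒0<n∸m a<k))
      p-inj r-inj r-disjoint p-adj (λ y _ → J.at-adj+ β y)
      (trans (sym tβ≡) (cong t (sym (+-identityʳ β)))) r-end

    backwardCycle : Σ (Cycle G) λ D → len D ≡ q + a
    backwardCycle = Gluing.gluedCycle p r′ q a 1≤q 0<a (+-mono-≤ 2≤q 0<a)
      p-inj r′-inj r′-disjoint p-adj r′-adj (trans (sym tβ≡) (sym (J.at-cong α+a≈β))) r′-end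

    k≤q+q : k ≤ q + q
    k≤q+q = +-cancelˡ-≤ k k (q + q) (begin
      k + k                    ≤⟨ +-mono-≤ (k≤len-of backwardCycle) (k≤len-of forwardCycle) ⟩
      (q + a) + (q + (k ∸ a))  ≡⟨ regroup q a (k ∸ a) ⟩
      (a + (k ∸ a)) + (q + q)  ≡⟨ cong (_+ (q + q)) (m+[n∸m]≡n (<⇒≤ a<k)) ⟩
      k + (q + q)              ∎)
      where
      open ≤-Reasoning
      k≤len-of : ∀ {m} → (Σ (Cycle G) λ D → len D ≡ m) → k ≤ m
      k≤len-of (D , refl) = k≤len D
      regroup : ∀ q a b → (q + a) + (q + b) ≡ (a + b) + (q + q)
      regroup = solve-∀

  -- A run of shared edges of Si, starting at position c₀, traverses Sj in a single direction.
  module Run (c₀ β : ℕ) (start : s c₀ ≡ t β) where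

    S : ℕ → Fin (n G)
    S x = s (c₀ + x)

    S0≡ : S 0 ≡ t β
    S0≡ = trans (cong s (+-identityʳ c₀)) start

    -- S x is at position β + x, respectively β − x, of Sj.
    Forward Backward : ℕ → Set
    Forward x = S x ≡ t (β + x)
    Backward x = ∃ λ γ → γ + x ≈ β × S x ≡ t γ

    Monotone : ℕ → Set
    Monotone ℓ = (∀ x → x ≤ ℓ → Forward x) ⊎ (∀ x → x ≤ ℓ → Backward x)

    private
      Forward0 : ∀ x → x ≤ 0 → Forward x
      Forward0 zero _ = trans S0≡ (cong t (sym (+-identityʳ β)))

      Backward0 : ∀ x → x ≤ 0 → Backward x
      Backward0 zero _ = β , ≡⇒≈ (+-identityʳ β) , S0≡

      no-return : ∀ x → S x ≢ S (suc (suc x))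
      no-return x e = ≉+2 (c₀ + x) (≈-trans (I.at-injective e) (≡⇒≈ (regroup c₀ x)))
        where
        regroup : ∀ c x → c + suc (suc x) ≡ c + x + 2
        regroup = solve-∀

      nextOnJ : ∀ {x γ} → S x ≡ t γ → Shared (c₀ + x) →
                S (suc x) ≡ t (suc γ) ⊎ ∃ λ γ′ → suc γ′ ≈ γ × S (suc x) ≡ t γ′
      nextOnJ {x} {γ} Sx≡ shared with J.InE⇒EdgeAt shared
      ... | y , _ , inj₁ (ty≡ , tsy≡) =
        inj₁ (trans (sym (trans tsy≡ S-suc)) (J.at-cong (+-congˡ 1 (J.at-injective (trans ty≡ Sx≡)))))
        where
        S-suc : s (suc (c₀ + x)) ≡ S (suc x)
        S-suc = cong s (sym (+-suc c₀ x))
      ... | y , _ , inj₂ (ty≡ , tsy≡) =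
        inj₂ (y , J.at-injective (trans tsy≡ Sx≡) , sym (trans ty≡ (cong s (sym (+-suc c₀ x)))))

      step : ∀ ℓ → Monotone ℓ → Shared (c₀ + ℓ) → Monotone (suc ℓ)
      step ℓ (inj₁ fw) shared with nextOnJ (fw ℓ ≤-refl) shared
      ... | inj₁ e = inj₁ (≤-extend ℓ fw (trans e (cong t (sym (+-suc β ℓ)))))
      step zero (inj₁ fw) shared | inj₂ (γ′ , 1+γ′≈ , e) =
        inj₂ (≤-extend 0 Backward0 (γ′ , ≈-trans (≡⇒≈ (+-comm γ′ 1)) (≈-trans 1+γ′≈ (≡⇒≈ (+-identityʳ β))) , e))
      step (suc ℓ) (inj₁ fw) shared | inj₂ (γ′ , 1+γ′≈ , e) =
        ⊥-elim (no-return ℓ (trans (fw ℓ (n≤1+n ℓ)) (trans (J.at-cong (≈-sym γ′≈)) (sym e))))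
        where
        γ′≈ : γ′ ≈ β + ℓ
        γ′≈ = +-cancelˡ-≈ 1 (≈-trans 1+γ′≈ (≡⇒≈ (+-suc β ℓ)))
      step ℓ (inj₂ bw) shared with bw ℓ ≤-refl
      ... | γ , γ+ℓ≈β , Sℓ≡ with nextOnJ Sℓ≡ shared
      ...   | inj₂ (γ′ , 1+γ′≈γ , e) =
        inj₂ (≤-extend ℓ bw (γ′ , ≈-trans (≡⇒≈ (+-suc γ′ ℓ)) (≈-trans (+-congʳ ℓ 1+γ′≈γ) γ+ℓ≈β) , e))
      step zero (inj₂ bw) shared | γ , γ+0≈β , _ | inj₁ e =
        inj₁ (≤-extend 0 Forward0 (trans e (J.at-cong (≈-trans (+-congˡ 1 (≈-trans (≡⇒≈ (sym (+-identityʳ γ))) γ+0≈β)) (≡⇒≈ (+-comm 1 β))))))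
      step (suc ℓ) (inj₂ bw) shared | γ , γ+1+ℓ≈β , _ | inj₁ e with bw ℓ (n≤1+n ℓ)
      ... | γ₂ , γ₂+ℓ≈β , Sℓ≡tγ₂ = ⊥-elim (no-return ℓ (trans Sℓ≡tγ₂ (trans (J.at-cong γ₂≈) (sym e))))
        where
        γ₂≈ : γ₂ ≈ suc γ
        γ₂≈ = +-cancelʳ-≈ ℓ (≈-trans γ₂+ℓ≈β (≈-trans (≈-sym γ+1+ℓ≈β) (≡⇒≈ (+-suc γ ℓ))))

    monotone : ∀ ℓ → (∀ x → x < ℓ → Shared (c₀ + x)) → Monotone ℓ
    monotone zero _ = inj₁ Forward0
    monotone (suc ℓ) shared = step ℓ (monotone ℓ (λ x x<ℓ → shared x (m<n⇒m<1+n x<ℓ))) (shared ℓ ≤-refl)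

  private
    sameForward : ∀ β → (∀ x → x ≤ k → s x ≡ t (β + x)) → SameSubgraph Ci Cj
    sameForward β fw = (λ v → V⊆ , V⊇) , (λ u v → E⊆ , E⊇)
      where
      s≡ : ∀ x → s x ≡ t (β + x)
      s≡ x = trans (I.at-cong (≈-sym (%-≈ x))) (trans (fw (x % k) (m%n≤n x k)) (J.at-cong (+-congˡ β (%-≈ x))))
      s-suc≡ : ∀ x → s (suc x) ≡ t (suc (β + x))
      s-suc≡ x = trans (s≡ (suc x)) (cong t (+-suc β x))
      V⊆ : ∀ {v} → InV Ci v → InV Cj v
      V⊆ h with I.InV⇒at h
      ... | x , _ , sx≡v = J.at⇒InV (trans (sym (s≡ x)) sx≡v)
      V⊇ : ∀ {v} → InV Cj v → InV Ci v
      V⊇ h with J.InV⇒at h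
      ... | y , _ , ty≡v with offset β y
      ...   | r , _ , β+r≈y = I.at⇒InV (trans (s≡ r) (trans (J.at-cong β+r≈y) ty≡v))
      E⊆ : ∀ {u v} → InE Ci u v → InE Cj u v
      E⊆ h with I.InE⇒EdgeAt h
      ... | x , _ , edge = J.EdgeAt⇒InE {β + x} (UnorderedEq-cong (sym (s≡ x)) (sym (s-suc≡ x)) edge)
      E⊇ : ∀ {u v} → InE Cj u v → InE Ci u v
      E⊇ h with J.InE⇒EdgeAt h
      ... | y , _ , edge with offset β y
      ...   | r , _ , β+r≈y = I.EdgeAt⇒InE {r}
        (UnorderedEq-cong (trans (s≡ r) (J.at-cong β+r≈y)) (trans (s-suc≡ r) (J.at-cong (+-congˡ 1 β+r≈y))) edge)

    sameBackward : ∀ β → (∀ x → x ≤ k → ∃ λ γ → γ + x ≈ β × s x ≡ t γ) → SameSubgraph Ci Cj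
    sameBackward β bw = (λ v → V⊆ , V⊇) , (λ u v → E⊆ , E⊇)
      where
      s≡ : ∀ x → ∃ λ γ → γ + x ≈ β × s x ≡ t γ
      s≡ x with bw (x % k) (m%n≤n x k)
      ... | γ , γ+x%k≈β , e = γ , ≈-trans (+-congˡ γ (≈-sym (%-≈ x))) γ+x%k≈β , trans (I.at-cong (≈-sym (%-≈ x))) e
      V⊆ : ∀ {v} → InV Ci v → InV Cj v
      V⊆ h with I.InV⇒at h
      ... | x , _ , sx≡v = J.at⇒InV (trans (sym (proj₂ (proj₂ (s≡ x)))) sx≡v)
      V⊇ : ∀ {v} → InV Cj v → InV Ci v
      V⊇ h with J.InV⇒at h
      ... | y , _ , ty≡v with offset y β
      ...   | r , _ , y+r≈β with s≡ r
      ...     | γ , γ+r≈β , sr≡ = I.at⇒InV (trans sr≡ (trans (J.at-cong (+-cancelʳ-≈ r (≈-trans γ+r≈β (≈-sym y+r≈β)))) ty≡v))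
      E⊆ : ∀ {u v} → InE Ci u v → InE Cj u v
      E⊆ h with I.InE⇒EdgeAt h
      ... | x , _ , edge with s≡ x | s≡ (suc x)
      ...   | γ , γ+x≈β , sx≡ | γ′ , γ′+1+x≈β , s1+x≡ =
        J.EdgeAt⇒InE {γ′} (UnorderedEq-cong (sym s1+x≡) (trans (J.at-cong 1+γ′≈γ) (sym sx≡)) (UnorderedEq-swap edge))
        where
        1+γ′≈γ : suc γ′ ≈ γ
        1+γ′≈γ = +-cancelʳ-≈ x (≈-trans (≡⇒≈ (sym (+-suc γ′ x))) (≈-trans γ′+1+x≈β (≈-sym γ+x≈β)))
      E⊇ : ∀ {u v} → InE Cj u v → InE Ci u v
      E⊇ h with J.InE⇒EdgeAt h
      ... | y , _ , edge with offset (suc y) β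
      ...   | r , _ , 1+y+r≈β with s≡ r | s≡ (suc r)
      ...     | γ , γ+r≈β , sr≡ | γ′ , γ′+1+r≈β , s1+r≡ =
        I.EdgeAt⇒InE {r} (UnorderedEq-cong (trans sr≡ (J.at-cong γ≈1+y)) (trans s1+r≡ (J.at-cong γ′≈y)) (UnorderedEq-swap edge))
        where
        γ≈1+y : γ ≈ suc y
        γ≈1+y = +-cancelʳ-≈ r (≈-trans γ+r≈β (≈-sym 1+y+r≈β))
        γ′≈y : γ′ ≈ y
        γ′≈y = +-cancelˡ-≈ 1 (+-cancelʳ-≈ r (≈-trans (≡⇒≈ (sym (+-suc γ′ r))) (≈-trans γ′+1+r≈β (≈-sym 1+y+r≈β))))

  allShared⇒same : (∀ x → Shared x) → SameSubgraph Ci Cj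
  allShared⇒same shared with J.InV⇒at (proj₁ (Shared⇒OnJ (shared 0)))
  ... | β , _ , tβ≡s0 with Run.monotone 0 β (sym tβ≡s0) k (λ x _ → shared x)
  ...   | inj₁ fw = sameForward β fw
  ...   | inj₂ bw = sameBackward β bw

  record HalfShared : Set where
    field
      i q      : ℕ
      k≡q+q    : k ≡ q + q
      unshared : ∀ e → e < q → ¬ Shared (i + e)
      shared   : ∀ d → d < q → Shared (i + q + d)

  private
    earStart : ∀ x₀ x₁ → ¬ Shared x₀ → Shared x₁ → ∃ λ i → OnJ (s i) × ¬ Shared i
    earStart x₀ x₁ ¬shared₀ shared₁ with offset x₁ x₀
    ... | r , _ , x₁+r≈x₀ with least (λ d → ¬? (shared? (x₁ + d))) r (¬shared₀ ∘ Shared-cong x₁+r≈x₀)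
    ...   | zero , _ , ¬shared , _ = ⊥-elim (¬shared (subst Shared (sym (+-identityʳ x₁)) shared₁))
    ...   | suc d , _ , ¬shared , below =
      x₁ + suc d , subst (OnJ ∘ s) (sym (+-suc x₁ d)) (proj₂ (Shared⇒OnJ (decidable-stable (shared? _) (below d ≤-refl)))) , ¬shared

    -- Starting from an ear, the edges of Si after the ear are all shared, since a second ear
    -- would have to be as long as the first while fitting into the rest of Si.
    module AfterEar (i : ℕ) (start : OnJ (s i)) (¬shared-i : ¬ Shared i) (x₁ x₂ : ℕ)
                    (shared₁ : Shared x₁) (shared₂ : Shared x₂) (x₁≉x₂ : ¬ x₁ ≈ x₂) where
      E = ear i x₁ start ¬shared-i shared₁
      open Ear E
      open EarCycles E

      locate : ∀ x → Shared x → ∃ λ e → e < k × i + e ≈ x × q ≤ e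
      locate x shared with offset i x
      ... | e , e<k , i+e≈x = e , e<k , i+e≈x , ≮⇒≥ λ e<q → unshared e e<q (Shared-cong (≈-sym i+e≈x) shared)

      2+q≤k : 2 + q ≤ k
      2+q≤k with locate x₁ shared₁ | locate x₂ shared₂
      ... | e₁ , e₁<k , i+e₁≈x₁ , q≤e₁ | e₂ , e₂<k , i+e₂≈x₂ , q≤e₂ =
        2+≤-if-distinct q e₁ e₂ k q≤e₁ q≤e₂ e₁<k e₂<k
          (λ e₁≡e₂ → x₁≉x₂ (≈-trans (≈-sym i+e₁≈x₁) (≈-trans (≡⇒≈ (cong (i +_) e₁≡e₂)) i+e₂≈x₂)))

      ℓ = k ∸ q

      q+ℓ≡k : q + ℓ ≡ k
      q+ℓ≡k = m+[n∸m]≡n (<⇒≤ q<k)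

      onJ-afterShared : ∀ d → (∀ j → j < d → Shared (i + q + j)) → OnJ (s (i + q + d))
      onJ-afterShared zero _ = subst (OnJ ∘ s) (sym (+-identityʳ (i + q))) end-onJ
      onJ-afterShared (suc d) shared = subst (OnJ ∘ s) (sym (+-suc (i + q) d)) (proj₂ (Shared⇒OnJ (shared d ≤-refl)))

      noSecondEar : ∀ d₀ → d₀ < ℓ → ¬ Shared (i + q + d₀) → (∀ j → j < d₀ → Shared (i + q + j)) → ⊥
      noSecondEar d₀ d₀<ℓ ¬shared shared-before with locate x₁ shared₁
      ... | e₁ , e₁<k , i+e₁≈x₁ , q≤e₁ = Ear.unshared E′ e′ e′<q′ (subst Shared i+e₁≡ (Shared-cong (≈-sym i+e₁≈x₁) shared₁))
        where
        i′ = i + q + d₀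
        E′ = ear i′ x₁ (onJ-afterShared d₀ shared-before) ¬shared shared₁
        q′ = Ear.q E′
        q+d₀<k : q + d₀ < k
        q+d₀<k = subst (q + d₀ <_) q+ℓ≡k (+-monoʳ-< q d₀<ℓ)
        w = k ∸ (q + d₀)
        i′+w≡i+k : i′ + w ≡ i + k
        i′+w≡i+k = trans (+-assoc (i + q) d₀ w) (trans (+-assoc i q (d₀ + w))
                     (cong (i +_) (trans (sym (+-assoc q d₀ w)) (m+[n∸m]≡n (<⇒≤ q+d₀<k)))))
        q′≤w : q′ ≤ w
        q′≤w = ≮⇒≥ λ w<q′ → Ear.interior-offJ E′ w (m<n⇒0<n∸m q+d₀<k) w<q′
                 (subst OnJ (sym (trans (cong s i′+w≡i+k) (I.at-cong (+K-≈ i)))) start)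
        tight = halves-tight k q q′ d₀ k≤q+q (EarCycles.k≤q+q E′)
                  (subst (q′ + (q + d₀) ≤_) (m∸n+n≡m (<⇒≤ q+d₀<k)) (+-monoˡ-≤ (q + d₀) q′≤w))
        e′ = e₁ ∸ q
        e′<q′ : e′ < q′
        e′<q′ = subst (e′ <_) (m+n∸n≡m q′ q) (subst (λ z → e′ < z ∸ q) (sym (proj₂ tight)) (∸-monoˡ-< e₁<k q≤e₁))
        i+e₁≡ : i + e₁ ≡ i′ + e′
        i+e₁≡ = begin
          i + e₁             ≡⟨ cong (i +_) (m+[n∸m]≡n q≤e₁) ⟨
          i + (q + e′)       ≡⟨ +-assoc i q e′ ⟨
          i + q + e′         ≡⟨ cong (_+ e′) (+-identityʳ (i + q)) ⟨
          i + q + 0 + e′     ≡⟨ cong (λ z → i + q + z + e′) (proj₁ tight) ⟨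
          i + q + d₀ + e′    ∎
          where open ≡-Reasoning

      rest-shared : ∀ d → d < ℓ → Shared (i + q + d)
      rest-shared d d<ℓ = decidable-stable (shared? _) λ ¬shared →
        let (d₀ , d₀≤d , ¬shared₀ , below) = least (λ x → ¬? (shared? (i + q + x))) d ¬shared
        in noSecondEar d₀ (≤-<-trans d₀≤d d<ℓ) ¬shared₀ (λ j j<d₀ → decidable-stable (shared? _) (below j j<d₀))

      open Run (i + q) β (sym tβ≡)

      Sℓ≡tα : S ℓ ≡ t α
      Sℓ≡tα = trans (cong s (trans (+-assoc i q ℓ) (cong (i +_) q+ℓ≡k))) (trans (I.at-cong (+K-≈ i)) (sym tα≡))

      cycle-q+q : Monotone ℓ → Σ (Cycle G) λ D → len D ≡ q + q
      cycle-q+q (inj₁ fw) = proj₁ backwardCycle , trans (proj₂ backwardCycle) (cong (q +_) a≡q)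
        where
        α≈β+ℓ : α ≈ β + ℓ
        α≈β+ℓ = J.at-injective (trans (sym Sℓ≡tα) (fw ℓ ≤-refl))
        a+ℓ≈0 : a + ℓ ≈ 0
        a+ℓ≈0 = ≈-sym (+-cancelˡ-≈ α (≈-trans (≡⇒≈ (+-identityʳ α))
                  (≈-trans α≈β+ℓ (≈-trans (+-congʳ ℓ (≈-sym α+a≈β)) (≡⇒≈ (+-assoc α a ℓ))))))
        a≡q : a ≡ q
        a≡q = ≈⇒≡ a<k q<k (+-cancelʳ-≈ ℓ (≈-trans a+ℓ≈0 (≈-trans (≈-sym K≈0) (≡⇒≈ (sym q+ℓ≡k)))))
      cycle-q+q (inj₂ bw) with bw ℓ ≤-refl
      ... | γ , γ+ℓ≈β , Sℓ≡tγ = proj₁ forwardCycle , trans (proj₂ forwardCycle) (cong (q +_) k∸a≡q)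
        where
        α≈γ : α ≈ γ
        α≈γ = J.at-injective (trans (sym Sℓ≡tα) Sℓ≡tγ)
        ℓ≡a : ℓ ≡ a
        ℓ≡a = ≈⇒≡ (∸-monoʳ-< {k} {q} {0} (≤-trans (s≤s z≤n) 2≤q) (<⇒≤ q<k)) a<k
                (+-cancelˡ-≈ α (≈-trans (+-congʳ ℓ α≈γ) (≈-trans γ+ℓ≈β (≈-sym α+a≈β))))
        k∸a≡q : k ∸ a ≡ q
        k∸a≡q = trans (cong (k ∸_) (sym ℓ≡a)) (m∸[m∸n]≡n (<⇒≤ q<k))

      k≡q+q : k ≡ q + q
      k≡q+q = trans (sym (len+4≤2k⇒len≡k D (subst (λ z → z + 4 ≤ k + k) (sym len-D)
                (subst (_≤ k + k) (regroup q) (+-mono-≤ 2+q≤k 2+q≤k))))) len-D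
        where
        D = proj₁ (cycle-q+q (monotone ℓ rest-shared))
        len-D : len D ≡ q + q
        len-D = proj₂ (cycle-q+q (monotone ℓ rest-shared))
        regroup : ∀ q → (2 + q) + (2 + q) ≡ q + q + 4
        regroup = solve-∀

  halfShared : ∀ x₀ x₁ x₂ → ¬ Shared x₀ → Shared x₁ → Shared x₂ → ¬ x₁ ≈ x₂ → HalfShared
  halfShared x₀ x₁ x₂ ¬shared₀ shared₁ shared₂ x₁≉x₂ with earStart x₀ x₁ ¬shared₀ shared₁
  ... | i , start , ¬shared-i = record
    { i = i ; q = q ; k≡q+q = k≡q+q ; unshared = unshared
    ; shared = λ d d<q → rest-shared d (subst (d <_) (sym ℓ≡q) d<q) }
    where
    open AfterEar i start ¬shared-i x₁ x₂ shared₁ shared₂ x₁≉x₂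
    open Ear E
    ℓ≡q : ℓ ≡ q
    ℓ≡q = trans (cong (_∸ q) k≡q+q) (m+n∸n≡m q q)

  CommonPair : Fin (n G) × Fin (n G) → Set
  CommonPair p = proj₁ p Fin.< proj₂ p × InE Ci (proj₁ p) (proj₂ p) × InE Cj (proj₁ p) (proj₂ p)

  common? : ∀ p → Dec (CommonPair p)
  common? p = (proj₁ p Fin.<? proj₂ p) ×-dec (inE? Ci (proj₁ p) (proj₂ p) ×-dec inE? Cj (proj₁ p) (proj₂ p))

  commonList : List (Fin (n G) × Fin (n G))
  commonList = filter common? (allPairs (n G))

  commonList-unique : Unique commonList
  commonList-unique = filter⁺ common? (allPairs-unique (n G))

  private
    ∈commonList⇒ : ∀ {p} → p ∈ commonList → CommonPair p
    ∈commonList⇒ p∈ = proj₂ (∈-filter⁻ common? {xs = allPairs (n G)} p∈)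

    sharedPosition : ∀ {u v} → InE Ci u v → InE Cj u v → ∃ λ x → I.EdgeAt x u v × Shared x
    sharedPosition ui vj with I.InE⇒EdgeAt ui
    ... | x , _ , edge = x , edge , InE-cong {C = Cj} edge vj

    sortEdge : ℕ → Fin (n G) × Fin (n G)
    sortEdge x = sortPair (s x) (s (suc x))

    sortEdge-≡ : ∀ {x p} → proj₁ p Fin.< proj₂ p → I.EdgeAt x (proj₁ p) (proj₂ p) → sortEdge x ≡ p
    sortEdge-≡ u<v edge = sortPair-sorted _ _ u<v edge

  twoShared : 2 ≤ length commonList → ∃₂ λ x₁ x₂ → Shared x₁ × Shared x₂ × ¬ x₁ ≈ x₂
  twoShared 2≤ with two-distinct-members commonList 2≤ commonList-unique
  ... | p₁ , p₂ , p₁∈ , p₂∈ , p₁≢p₂ with ∈commonList⇒ p₁∈ | ∈commonList⇒ p₂∈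
  ...   | <₁ , ui₁ , uj₁ | <₂ , ui₂ , uj₂ with sharedPosition ui₁ uj₁ | sharedPosition ui₂ uj₂
  ...     | x₁ , edge₁ , shared₁ | x₂ , edge₂ , shared₂ = x₁ , x₂ , shared₁ , shared₂ ,
    λ x₁≈x₂ → p₁≢p₂ (trans (sym (sortEdge-≡ <₁ edge₁)) (sortEdge-≡ <₂ (I.EdgeAt-cong (≈-sym x₁≈x₂) edge₂)))

  unsharedEdge : ¬ SameSubgraph Ci Cj → ∃ λ x₀ → ¬ Shared x₀
  unsharedEdge ¬same with all? {n = k} (shared? ∘ toℕ)
  ... | yes all-shared = ⊥-elim (¬same (allShared⇒same λ x →
          Shared-cong (≈-trans (≡⇒≈ (toℕ-fromℕ< (m%n<n x k))) (%-≈ x)) (all-shared (fromℕ< (m%n<n x k)))))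
  ... | no ¬all-shared = let (x₀ , ¬shared) = ¬∀⟶∃¬ k _ (shared? ∘ toℕ) ¬all-shared in toℕ x₀ , ¬shared

  length-commonList : (H : HalfShared) → length commonList ≡ HalfShared.q H
  length-commonList H = length-enumerated commonList commonList-unique q g g-inj g∈ onto
    where
    open HalfShared H
    q<k : q < k
    q<k = subst (q <_) (sym k≡q+q) (m<m+n q (n≢0⇒n>0 q≢0))
      where
      q≢0 : q ≢ 0
      q≢0 refl = case subst (3 ≤_) k≡q+q 3≤k of λ ()
    X : Fin q → ℕ
    X d = i + q + toℕ d
    g : Fin q → Fin (n G) × Fin (n G)
    g d = sortEdge (X d)
    g-inj : ∀ {d d′} → g d ≡ g d′ → d ≡ d′
    g-inj {d} {d′} e with sortPair-injective e
    ... | inj₁ (same , _) = toℕ-injective (I.at-injective+ (i + q) (<-trans (toℕ<n d) q<k) (<-trans (toℕ<n d′) q<k) same)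
    ... | inj₂ (e₁ , e₂) = ⊥-elim (≉+2 (X d′) (≈-trans (≈-sym (I.at-injective e₂))
                                     (≈-trans (+-congˡ 1 (I.at-injective e₁)) (≡⇒≈ (+-comm 2 (X d′))))))
    g-common : ∀ d → CommonPair (g d)
    g-common d = sortPair-< _ _ s≢s-suc
               , InE-cong {C = Ci} sorted (I.EdgeAt⇒InE {X d} (inj₁ (refl , refl)))
               , InE-cong {C = Cj} sorted (shared (toℕ d) (toℕ<n d))
      where
      sorted = UnorderedEq-sym (sortPair-cases (s (X d)) (s (suc (X d))))
      s≢s-suc : s (X d) ≢ s (suc (X d))
      s≢s-suc e = case I.at-injective+ (X d) {0} {1} (≤-trans (s≤s z≤n) 3≤k) (≤-trans (s≤s (s≤s z≤n)) 3≤k)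
                    (subst₂ (λ a b → s a ≡ s b) (sym (+-identityʳ (X d))) (+-comm 1 (X d)) e) of λ ()
    g∈ : ∀ d → g d ∈ commonList
    g∈ d = ∈-filter⁺ common? {xs = allPairs (n G)} (∈-allPairs (g d)) (g-common d)
    onto : ∀ p → p ∈ commonList → ∃ λ d → g d ≡ p
    onto p p∈ with ∈commonList⇒ p∈
    ... | u<v , ui , uj with sharedPosition ui uj
    ...   | x , edge , shared-x with offset i x
    ...     | e , e<k , i+e≈x = fromℕ< e′<q , trans (cong sortEdge X≡) (sortEdge-≡ u<v (I.EdgeAt-cong (≈-sym i+e≈x) edge))
      where
      q≤e : q ≤ e
      q≤e = ≮⇒≥ λ e<q → unshared e e<q (Shared-cong (≈-sym i+e≈x) shared-x)
      e′ = e ∸ q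
      e′<q : e′ < q
      e′<q = subst (e′ <_) (m+n∸n≡m q q) (∸-monoˡ-< (subst (e <_) k≡q+q e<k) q≤e)
      X≡ : X (fromℕ< e′<q) ≡ i + e
      X≡ = trans (cong (i + q +_) (toℕ-fromℕ< e′<q)) (trans (+-assoc i q e′) (cong (i +_) (m+[n∸m]≡n q≤e)))

  private
    halfOfK : ∃₂ (λ x₁ x₂ → Shared x₁ × Shared x₂ × ¬ x₁ ≈ x₂) → ∃ (λ x₀ → ¬ Shared x₀) →
              ∃ λ h → k ≡ 2 * h × length commonList ≡ h
    halfOfK (x₁ , x₂ , shared₁ , shared₂ , x₁≉x₂) (x₀ , ¬shared₀) =
      q , trans k≡q+q (cong (q +_) (sym (+-identityʳ q))) , length-commonList H
      where
      H = halfShared x₀ x₁ x₂ ¬shared₀ shared₁ shared₂ x₁≉x₂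
      open HalfShared H

  commonEdges≤1⊎half : ¬ SameSubgraph Ci Cj →
    commonEdges Ci Cj ≤ 1 ⊎ ∃ λ h → k ≡ 2 * h × commonEdges Ci Cj ≡ h
  commonEdges≤1⊎half ¬same with length commonList ≤? 1
  ... | yes ≤1 = inj₁ ≤1
  ... | no ≰1 = inj₂ (halfOfK (twoShared (≰⇒> ≰1)) (unsharedEdge ¬same))

lemma1 : (k : ℕ) → 5 ≤ k → (G : Graph) → Connected G → SC k G →
    (Si Sj : InducedCycle G) → ¬ SameSubgraph (cyc Si) (cyc Sj) →
    (commonVertices (cyc Si) (cyc Sj) ≤ 1)
    ⊎ (commonEdges (cyc Si) (cyc Sj) ≤ 1)
    ⊎ (∃ λ h → (k ≡ 2 * h) × (commonEdges (cyc Si) (cyc Sj) ≡ h))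
lemma1 k _ G _ (inj₁ acyclic) Si Sj _ = ⊥-elim (acyclic (cyc Si))
lemma1 k _ G _ (inj₂ induced≡k) Si Sj ¬same = inj₂ (TwoCycles.commonEdges≤1⊎half k induced≡k Si Sj ¬same)
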